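{- Let $G$ be the complete sun graph on $2n$ vertices ($n\ge 3$). Then \[\varphi(G^2)=\begin{cases} n^2+1 & \text{if } n \text{ is odd},\\ \frac{n}{2}(2n-1) & \text{if } n \text{ is even}.\end{cases}\]
   Context: All graphs are simple and finite. An $n$-sun ($n\ge3$) is a chordal graph on $2n$ vertices whose vertex set is partitioned into $U=\{u_1,\dots,u_n\}$ and $W=\{w_1,\dots,w_n\}$ such that $W$ is an independent set and $w_j$ is adjacent to $u_i$ if and only if $j=i$ or $j\equiv i+1 \pmod n$. A complete sun is a sun in which the induced subgraph on $U$ is complete. $\mathbb{N}_0$ denotes the set of non-negative integers. For non-empty $A,B\subseteq\mathbb{N}_0$, $A+B=\{a+b: a\in A, b\in B\}$. An integer additive set-indexer (IASI) of a graph $G$ is an injective function $f:V(G)\to\mathcal{P}(\mathbb{N}_0)$ with non-empty values such that the induced map $f^+(uv)=f(u)+f(v)$ on $E(G)$ is also injective. An IASI is weak if $|f^+(uv)|=\max(|f(u)|,|f(v)|)$ for every edge $uv$. An element (vertex or edge) is mono-indexed if its set-label has cardinality $1$. The sparing number $\varphi(H)$ of a graph $H$ is the minimum number of mono-indexed edges over all weak IASIs of $H$. The square $G^2$ of $G$ has vertex set $V(G)$, two distinct vertices adjacent iff their distance in $G$ is at most $2$. -}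

module Defs where

open import Data.Bool using (Bool; true; false; not; _∧_; _∨_)
open import Data.Nat using (ℕ; zero; suc; _≤_; _⊔_; _<ᵇ_; _≡ᵇ_)
import Data.Nat as ℕ
open import Data.Fin using (Fin; toℕ; splitAt)
open import Data.Sum using (_⊎_; inj₁; inj₂)
open import Data.Product using (_×_; _,_; Σ; proj₁; proj₂)
open import Data.List using (List; []; length; map; concatMap; allFin; cartesianProduct; filterᵇ; deduplicate)
open import Data.Bool.ListAction using (any)
open import Data.List.Membership.Propositional using (_∈_)
open import Relation.Binary.PropositionalEquality using (_≡_; _≢_)

-- Finite sets of non-negative integers, represented by lists.
-- Set equality is extensional (same members); cardinality counts
-- distinct members.

SetEq : List ℕ → List ℕ → Set
SetEq A B = ∀ x → (x ∈ A → x ∈ B) × (x ∈ B → x ∈ A)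

card : List ℕ → ℕ
card A = length (deduplicate ℕ._≟_ A)

sumset : List ℕ → List ℕ → List ℕ
sumset A B = concatMap (λ a → map (λ b → a ℕ.+ b) B) A

-- Simple graphs on vertex set Fin N, given by a Boolean adjacency
-- relation (symmetric and irreflexive for the graphs used below).

Adj : ℕ → Set
Adj N = Fin N → Fin N → Bool

finEq : ∀ {N} → Fin N → Fin N → Bool
finEq i j = toℕ i ≡ᵇ toℕ j

square : ∀ {N} → Adj N → Adj N
square {N} adj i j =
  not (finEq i j) ∧ (adj i j ∨ any (λ k → adj i k ∧ adj k j) (allFin N))

-- Vertex set Fin (n + n):
-- the first n vertices are u_0,…,u_{n-1} (inj₁ under splitAt), the last
-- n are w_0,…,w_{n-1} (inj₂).  U is a clique, W is independent, and
-- w_j ~ u_i iff j = i or j ≡ i + 1 (mod n).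

wuAdj : (n : ℕ) → Fin n → Fin n → Bool
wuAdj n j i =
  (toℕ j ≡ᵇ toℕ i) ∨ (toℕ j ≡ᵇ suc (toℕ i))
    ∨ ((toℕ j ≡ᵇ 0) ∧ (suc (toℕ i) ≡ᵇ n))

sunAdj⊎ : (n : ℕ) → Fin n ⊎ Fin n → Fin n ⊎ Fin n → Bool
sunAdj⊎ n (inj₁ i) (inj₁ j) = not (finEq i j)
sunAdj⊎ n (inj₁ i) (inj₂ j) = wuAdj n j i
sunAdj⊎ n (inj₂ j) (inj₁ i) = wuAdj n j i
sunAdj⊎ n (inj₂ i) (inj₂ j) = false

completeSun : (n : ℕ) → Adj (n ℕ.+ n)
completeSun n x y = sunAdj⊎ n (splitAt n x) (splitAt n y)

record WeakIASI (N : ℕ) (adj : Adj N) : Set where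
  field
    f        : Fin N → List ℕ
    nonempty : ∀ v → f v ≢ []
    f-inj    : ∀ u v → SetEq (f u) (f v) → u ≡ v
    f⁺-inj   : ∀ u v u′ v′ → adj u v ≡ true → adj u′ v′ ≡ true →
               SetEq (sumset (f u) (f v)) (sumset (f u′) (f v′)) →
               (u ≡ u′ × v ≡ v′) ⊎ (u ≡ v′ × v ≡ u′)
    weak     : ∀ u v → adj u v ≡ true →
               card (sumset (f u) (f v)) ≡ card (f u) ⊔ card (f v)

monoEdges : ∀ {N} {adj : Adj N} → WeakIASI N adj → ℕ
monoEdges {N} {adj} g =
  length (filterᵇ
    (λ p → (toℕ (proj₁ p) <ᵇ toℕ (proj₂ p)) ∧ adj (proj₁ p) (proj₂ p)
             ∧ (card (sumset (f (proj₁ p)) (f (proj₂ p))) ≡ᵇ 1))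
    (cartesianProduct (allFin N) (allFin N)))
  where open WeakIASI g

IsSparingNumber : (N : ℕ) → Adj N → ℕ → Set
IsSparingNumber N adj m =
  Σ (WeakIASI N adj) (λ g → monoEdges g ≡ m)
    × (∀ (g : WeakIASI N adj) → m ≤ monoEdges g)

module Submission where

-- In G² the vertices u_i form a clique and are adjacent to every w_j, while
-- W induces the cycle ℤ_n (w_j meets w_(j±1) through u_j or u_(j-1)); hence
-- deg u = 2n - 1 and deg w = n + 2.  For a weak IASI, a sumset A + B with
-- |A|, |B| ≥ 2 is strictly larger than both, so every edge has a mono-indexed
-- end, and an edge is mono-indexed exactly when both ends are.  Counting
-- ordered pairs then gives
--   2·(mono-indexed edges) + 2·(total degree of the other, "spared", vertices)
--     = Σ deg,
-- so the sparing number is found by maximising the spared degree.  Spared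
-- vertices are independent: either a single u_i, or at most ⌊n/2⌋ vertices of
-- the cycle W; so at most ⌊n/2⌋(n + 2) is spared.  Labelling x by {2^x}, or by
-- {2^x, 2^x + 1} for the odd-indexed w_j, attains this bound.

open import Defs
open import Data.Bool using (Bool; true; false; not; _∧_; _∨_; T; if_then_else_)
open import Data.Bool.Properties using (T-≡; ∧-comm; ∧-zeroʳ; not-involutive)
open import Data.Bool.ListAction using (any)
open import Data.Nat using (ℕ; zero; suc; pred; _+_; _*_; _∸_; _≤_; _<_; z≤n; s≤s; _≡ᵇ_; _<ᵇ_; _⊔_; _^_)
open import Data.Nat.Properties
open import Data.Nat.DivMod using (_/_; _%_; m≡m%n+[m/n]*n; m/n≡1+[m∸n]/n; /-monoˡ-≤; m*n/n≡m)
open import Data.Nat.Logarithm using (⌊log₂_⌋; ⌊log₂[2^n]⌋≡n)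
open import Data.Nat.ListAction using () renaming (sum to listSum)
open import Data.Nat.ListAction.Properties using (sum-++)
open import Data.Nat.Tactic.RingSolver using (solve-∀)
open import Data.Fin using (Fin; zero; suc; toℕ; _↑ˡ_; _↑ʳ_; splitAt)
open import Data.Fin.Properties
  using (toℕ<n; toℕ-injective; toℕ-↑ˡ; toℕ-↑ʳ; splitAt-↑ˡ; splitAt-↑ʳ; splitAt⁻¹-↑ˡ; splitAt⁻¹-↑ʳ)
open import Data.List
  using (List; []; _∷_; length; map; _++_; tabulate; filterᵇ; cartesianProduct; allFin; deduplicate)
open import Data.List.Properties using (map-++; map-∘; map-tabulate; length-map; length-removeAt′)
open import Data.List.Membership.Propositional using (_∈_; lose; find)
open import Data.List.Membership.Propositional.Properties
  using (∈-map⁺; ∈-map⁻; ∈-concatMap⁺; ∈-concatMap⁻; ∈-deduplicate⁺; ∈-deduplicate⁻; ∈-allFin)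
open import Data.List.Relation.Unary.Any using (here; there; _─_)
open import Data.List.Relation.Unary.Any.Properties using (any⁺; any⁻)
open import Data.List.Relation.Unary.All as All using (_∷_)
open import Data.List.Relation.Unary.AllPairs using (_∷_)
open import Data.List.Relation.Unary.Unique.Propositional using (Unique)
open import Data.List.Relation.Unary.Unique.Propositional.Properties using (map⁺)
open import Data.List.Relation.Unary.Unique.DecPropositional.Properties _≟_ using (deduplicate-!)
import Data.List.Extrema.Nat as Extrema
open import Data.Product using (_×_; _,_; ∃; proj₁; proj₂)
open import Data.Sum using (_⊎_; inj₁; inj₂; [_,_]′)
open import Data.Empty using (⊥; ⊥-elim)
open import Function using (_∘_; id; Equivalence)
open import Relation.Binary.PropositionalEquality
open import Relation.Binary.Definitions using (tri<; tri≈; tri>)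
open import Relation.Nullary using (¬_; yes; no)
open import Algebra.Properties.Semiring.Sum +-*-semiring
  using (sum; sum-syntax; sum-cong-≗; ∑-distrib-+; ∑-comm; *-distribˡ-sum)

ind : Bool → ℕ
ind true = 1
ind false = 0

false≢true : false ≢ true
false≢true ()

∧-true⁻ : ∀ {x y} → x ∧ y ≡ true → x ≡ true × y ≡ true
∧-true⁻ {true} {true} _ = refl , refl

∧-true⁺ : ∀ {x y} → x ≡ true → y ≡ true → x ∧ y ≡ true
∧-true⁺ refl refl = refl

∨-true⁻ : ∀ {x y} → x ∨ y ≡ true → x ≡ true ⊎ y ≡ true
∨-true⁻ {true} _ = inj₁ refl
∨-true⁻ {false} p = inj₂ p

∨-trueˡ : ∀ {x y} → x ≡ true → x ∨ y ≡ true
∨-trueˡ refl = refl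

∨-trueʳ : ∀ {x y} → y ≡ true → x ∨ y ≡ true
∨-trueʳ {true} _ = refl
∨-trueʳ {false} p = p

not-true⁻ : ∀ {x} → not x ≡ true → x ≡ false
not-true⁻ {false} _ = refl

bool-ext : ∀ {x y} → (x ≡ true → y ≡ true) → (y ≡ true → x ≡ true) → x ≡ y
bool-ext {true} to _ = sym (to refl)
bool-ext {false} {true} _ from = from refl
bool-ext {false} {false} _ _ = refl

ind-∨ : ∀ x y → (x ≡ true → y ≡ true → ⊥) → ind (x ∨ y) ≡ ind x + ind y
ind-∨ true true excl = ⊥-elim (excl refl refl)
ind-∨ true false _ = refl
ind-∨ false y _ = refl

ind≤1 : ∀ x → ind x ≤ 1
ind≤1 true = ≤-refl
ind≤1 false = z≤n

ind-not : ∀ x → ind (not x) + ind x ≡ 1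
ind-not true = refl
ind-not false = refl

≡ᵇ⇒≡′ : ∀ {a b} → (a ≡ᵇ b) ≡ true → a ≡ b
≡ᵇ⇒≡′ {a} {b} p = ≡ᵇ⇒≡ a b (subst T (sym p) _)

≡⇒≡ᵇ′ : ∀ {a b} → a ≡ b → (a ≡ᵇ b) ≡ true
≡⇒≡ᵇ′ {a} {b} p with a ≡ᵇ b in eq
... | true = refl
... | false = ⊥-elim (subst T eq (≡⇒≡ᵇ a b p))

≢⇒≡ᵇ-false : ∀ {a b} → a ≢ b → (a ≡ᵇ b) ≡ false
≢⇒≡ᵇ-false {a} {b} a≢b with a ≡ᵇ b in eq
... | true = ⊥-elim (a≢b (≡ᵇ⇒≡′ eq))
... | false = refl

≢⇒not-≡ᵇ : ∀ {a b} → a ≢ b → not (a ≡ᵇ b) ≡ true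
≢⇒not-≡ᵇ a≢b = cong not (≢⇒≡ᵇ-false a≢b)

not-≡ᵇ⇒≢ : ∀ {a b} → not (a ≡ᵇ b) ≡ true → a ≢ b
not-≡ᵇ⇒≢ {a} {b} a≢b a≡b with trans (sym (not-true⁻ a≢b)) (≡⇒≡ᵇ′ a≡b)
... | ()

≡ᵇ-sym : ∀ a b → (a ≡ᵇ b) ≡ (b ≡ᵇ a)
≡ᵇ-sym a b = bool-ext (λ p → ≡⇒≡ᵇ′ (sym (≡ᵇ⇒≡′ {a} p))) (λ p → ≡⇒≡ᵇ′ (sym (≡ᵇ⇒≡′ {b} p)))

<⇒<ᵇ′ : ∀ {a b} → a < b → (a <ᵇ b) ≡ true
<⇒<ᵇ′ {a} {b} a<b with a <ᵇ b in eq
... | true = refl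
... | false = ⊥-elim (subst T eq (<⇒<ᵇ a<b))

≮⇒<ᵇ-false : ∀ {a b} → ¬ a < b → (a <ᵇ b) ≡ false
≮⇒<ᵇ-false {a} {b} a≮b with a <ᵇ b in eq
... | true = ⊥-elim (a≮b (<ᵇ⇒< a b (subst T (sym eq) _)))
... | false = refl

-- Finite sums over Fin n, using the library's ∑ for the semiring ℕ.  The
-- wrappers sum-cong and sum-+ only make the length n explicit, which Agda
-- cannot infer from a sum.

sum-cong : ∀ n {f g : Fin n → ℕ} → (∀ i → f i ≡ g i) → sum f ≡ sum g
sum-cong n = sum-cong-≗

sum-+ : ∀ n (f g : Fin n → ℕ) → ∑[ i < n ] (f i + g i) ≡ sum f + sum g
sum-+ n = ∑-distrib-+

sum-const : ∀ n c → ∑[ i < n ] c ≡ n * c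
sum-const zero c = refl
sum-const (suc n) c = cong (c +_) (sum-const n c)

sum-zero : ∀ n → ∑[ i < n ] 0 ≡ 0
sum-zero n = trans (sum-const n 0) (*-zeroʳ n)

sum-mono : ∀ n {f g : Fin n → ℕ} → (∀ i → f i ≤ g i) → sum f ≤ sum g
sum-mono zero _ = z≤n
sum-mono (suc n) f≤g = +-mono-≤ (f≤g zero) (sum-mono n (f≤g ∘ suc))

sum-*ʳ : ∀ n (f : Fin n → ℕ) c → ∑[ i < n ] (f i * c) ≡ sum f * c
sum-*ʳ zero f c = refl
sum-*ʳ (suc n) f c = trans (cong (f zero * c +_) (sum-*ʳ n (f ∘ suc) c)) (sym (*-distribʳ-+ c (f zero) _))

sum-split : ∀ m n (f : Fin (m + n) → ℕ) → sum f ≡ ∑[ i < m ] f (i ↑ˡ n) + ∑[ j < n ] f (m ↑ʳ j)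
sum-split zero n f = refl
sum-split (suc m) n f = trans (cong (f zero +_) (sum-split m n (f ∘ suc))) (sym (+-assoc (f zero) _ _))

count-index : ∀ n c → ∑[ k < n ] ind (toℕ k ≡ᵇ c) ≡ ind (c <ᵇ n)
count-index zero c = refl
count-index (suc n) zero = cong suc (sum-zero n)
count-index (suc n) (suc c) = count-index n c

count-index-< : ∀ {n c} → c < n → ∑[ k < n ] ind (toℕ k ≡ᵇ c) ≡ 1
count-index-< {n} {c} c<n = trans (count-index n c) (cong ind (<⇒<ᵇ′ c<n))

count-witness : ∀ n (p : Fin n → Bool) → ∑[ i < n ] ind (p i) ≢ 0 → ∃ λ i → p i ≡ true
count-witness zero p nz = ⊥-elim (nz refl)
count-witness (suc n) p nz with p zero in eq
... | true = zero , eq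
... | false with count-witness n (p ∘ suc) nz
... | i , pi = suc i , pi

count-filter : ∀ {A : Set} (p : A → Bool) xs → length (filterᵇ p xs) ≡ listSum (map (ind ∘ p) xs)
count-filter p [] = refl
count-filter p (x ∷ xs) with p x
... | true = cong suc (count-filter p xs)
... | false = count-filter p xs

sum-tabulate : ∀ {n} (f : Fin n → ℕ) → listSum (tabulate f) ≡ sum f
sum-tabulate {zero} f = refl
sum-tabulate {suc n} f = cong (f zero +_) (sum-tabulate (f ∘ suc))

sum-pairs : ∀ {A B : Set} {m n} (f : Fin m → A) (g : Fin n → B) (c : A × B → ℕ) →
  listSum (map c (cartesianProduct (tabulate f) (tabulate g))) ≡ ∑[ i < m ] ∑[ j < n ] c (f i , g j)
sum-pairs {m = zero} f g c = refl
sum-pairs {A} {B} {suc m} {n} f g c = begin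
  listSum (map c (row ++ rest))                ≡⟨ cong listSum (map-++ c row rest) ⟩
  listSum (map c row ++ map c rest)            ≡⟨ sum-++ (map c row) (map c rest) ⟩
  listSum (map c row) + listSum (map c rest)  ≡⟨ cong₂ _+_ row-sum (sum-pairs (f ∘ suc) g c) ⟩
  ∑[ j < n ] c (f zero , g j) + ∑[ i < m ] ∑[ j < n ] c (f (suc i) , g j) ∎
  where
    open ≡-Reasoning
    row rest : List (A × B)
    row = map (f zero ,_) (tabulate g)
    rest = cartesianProduct (tabulate (f ∘ suc)) (tabulate g)
    row-sum : listSum (map c row) ≡ ∑[ j < n ] c (f zero , g j)
    row-sum = trans (cong listSum (trans (sym (map-∘ (tabulate g))) (map-tabulate g _))) (sum-tabulate (λ j → c (f zero , g j)))

count-pairs : ∀ N (p : Fin N × Fin N → Bool) →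
  length (filterᵇ p (cartesianProduct (allFin N) (allFin N))) ≡ ∑[ i < N ] ∑[ j < N ] ind (p (i , j))
count-pairs N p = trans (count-filter p (cartesianProduct (allFin N) (allFin N))) (sum-pairs id id (ind ∘ p))

Symmetric : ∀ {N} → (Fin N → Fin N → Bool) → Set
Symmetric h = ∀ i j → h i j ≡ h j i

Loopless : ∀ {N} → (Fin N → Fin N → Bool) → Set
Loopless h = ∀ i j → h i j ≡ true → toℕ i ≢ toℕ j

degree : ∀ {N} → (Fin N → Fin N → Bool) → Fin N → ℕ
degree {N} h i = ∑[ j < N ] ind (h i j)

sum₂-+ : ∀ N (f g : Fin N → Fin N → ℕ) →
  ∑[ i < N ] ∑[ j < N ] (f i j + g i j) ≡ ∑[ i < N ] ∑[ j < N ] f i j + ∑[ i < N ] ∑[ j < N ] g i j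
sum₂-+ N f g = trans (sum-cong N (λ i → sum-+ N (f i) (g i)))
  (sum-+ N (λ i → ∑[ j < N ] f i j) (λ i → ∑[ j < N ] g i j))

count-unordered : ∀ N (h : Fin N → Fin N → Bool) → Symmetric h → Loopless h →
  (∑[ i < N ] ∑[ j < N ] ind ((toℕ i <ᵇ toℕ j) ∧ h i j)) * 2 ≡ ∑[ i < N ] ∑[ j < N ] ind (h i j)
count-unordered N h sym-h loopless = sym (begin
  ∑[ i < N ] ∑[ j < N ] ind (h i j)            ≡⟨ sum-cong N (λ i → sum-cong N (split i)) ⟩
  ∑[ i < N ] ∑[ j < N ] (below i j + below j i) ≡⟨ sum₂-+ N below (λ i j → below j i) ⟩
  B + ∑[ i < N ] ∑[ j < N ] below j i           ≡⟨ cong (B +_) (∑-comm (λ i j → below j i)) ⟩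
  B + B                                         ≡⟨ +-*-twice B ⟩
  B * 2                                         ∎)
  where
    open ≡-Reasoning
    below : Fin N → Fin N → ℕ
    below i j = ind ((toℕ i <ᵇ toℕ j) ∧ h i j)
    B : ℕ
    B = ∑[ i < N ] ∑[ j < N ] below i j
    +-*-twice : ∀ x → x + x ≡ x * 2
    +-*-twice = solve-∀
    split : ∀ i j → ind (h i j) ≡ below i j + below j i
    split i j with h i j in hij
    ... | false rewrite trans (sym-h j i) hij | ∧-zeroʳ (toℕ i <ᵇ toℕ j) | ∧-zeroʳ (toℕ j <ᵇ toℕ i) = refl
    ... | true rewrite trans (sym-h j i) hij with <-cmp (toℕ i) (toℕ j)
    ...   | tri< i<j _ j≮i rewrite <⇒<ᵇ′ i<j | ≮⇒<ᵇ-false j≮i = refl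
    ...   | tri≈ _ i≡j _ = ⊥-elim (loopless i j hij i≡j)
    ...   | tri> i≮j _ j<i rewrite <⇒<ᵇ′ j<i | ≮⇒<ᵇ-false i≮j = refl

-- Handshake lemma relative to a vertex cover m: every ordered edge pair either
-- lies inside m or has exactly one endpoint outside m, which it is counted from.
handshake-cover : ∀ N (h : Fin N → Fin N → Bool) (m : Fin N → Bool) → Symmetric h →
  (∀ i j → h i j ≡ true → m i ∨ m j ≡ true) →
  ∑[ i < N ] ∑[ j < N ] ind (h i j ∧ (m i ∧ m j)) + 2 * ∑[ i < N ] (ind (not (m i)) * degree h i)
    ≡ ∑[ i < N ] ∑[ j < N ] ind (h i j)
handshake-cover N h m sym-h cover = sym (begin
  ∑[ i < N ] ∑[ j < N ] ind (h i j)                       ≡⟨ sum-cong N (λ i → sum-cong N (split i)) ⟩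
  ∑[ i < N ] ∑[ j < N ] (inside i j + (out i j + out j i)) ≡⟨ sum₂-+ N inside _ ⟩
  I + ∑[ i < N ] ∑[ j < N ] (out i j + out j i)           ≡⟨ cong (I +_) (sum₂-+ N out (λ i j → out j i)) ⟩
  I + (X + ∑[ i < N ] ∑[ j < N ] out j i)                 ≡⟨ cong (λ y → I + (X + y)) (∑-comm (λ i j → out j i)) ⟩
  I + (X + X)                                             ≡⟨ cong (I +_) (sym (+-*-twice X)) ⟩
  I + 2 * X                                               ≡⟨ cong (λ y → I + 2 * y) (sum-cong N row) ⟩
  I + 2 * ∑[ i < N ] (ind (not (m i)) * degree h i)        ∎)
  where
    open ≡-Reasoning
    inside out : Fin N → Fin N → ℕ
    inside i j = ind (h i j ∧ (m i ∧ m j))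
    out i j = ind (not (m i)) * ind (h i j)
    I X : ℕ
    I = ∑[ i < N ] ∑[ j < N ] inside i j
    X = ∑[ i < N ] ∑[ j < N ] out i j
    +-*-twice : ∀ x → 2 * x ≡ x + x
    +-*-twice = solve-∀
    row : ∀ i → ∑[ j < N ] out i j ≡ ind (not (m i)) * degree h i
    row i = sym (*-distribˡ-sum (ind (not (m i))) (λ j → ind (h i j)))
    split : ∀ i j → ind (h i j) ≡ inside i j + (out i j + out j i)
    split i j rewrite sym-h j i with h i j in hij | m i in mi | m j in mj
    ... | false | a | b = sym (cong₂ _+_ (*-zeroʳ (ind (not a))) (*-zeroʳ (ind (not b))))
    ... | true | true | true = refl
    ... | true | true | false = refl
    ... | true | false | true = refl
    ... | true | false | false with trans (sym (cong₂ _∨_ mi mj)) (cover i j hij)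
    ...   | ()

∈-─ : ∀ {x y : ℕ} xs (x∈ : x ∈ xs) → y ∈ xs → y ≢ x → y ∈ (xs ─ x∈)
∈-─ (_ ∷ _) (here refl) (here refl) y≢x = ⊥-elim (y≢x refl)
∈-─ (_ ∷ _) (here refl) (there y∈) _ = y∈
∈-─ (_ ∷ _) (there x∈) (here refl) _ = here refl
∈-─ (_ ∷ xs) (there x∈) (there y∈) y≢x = there (∈-─ xs x∈ y∈ y≢x)

unique-⊆-length : ∀ (xs ys : List ℕ) → Unique xs → (∀ {z} → z ∈ xs → z ∈ ys) → length xs ≤ length ys
unique-⊆-length [] ys _ _ = z≤n
unique-⊆-length (x ∷ xs) ys (x∉xs ∷ uxs) xs⊆ys =
  subst (suc (length xs) ≤_) (sym (length-removeAt′ ys _))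
    (s≤s (unique-⊆-length xs (ys ─ x∈ys) uxs
      (λ z∈xs → ∈-─ ys x∈ys (xs⊆ys (there z∈xs)) (λ z≡x → All.lookup x∉xs z∈xs (sym z≡x)))))
  where
    x∈ys : x ∈ ys
    x∈ys = xs⊆ys (here refl)

card-mono : ∀ A B → (∀ {z} → z ∈ A → z ∈ B) → card A ≤ card B
card-mono A B A⊆B = unique-⊆-length _ _ (deduplicate-! A)
  (λ z∈ → ∈-deduplicate⁺ _≟_ (A⊆B (∈-deduplicate⁻ _≟_ A z∈)))

∈-sumset⁺ : ∀ {a b} A B → a ∈ A → b ∈ B → a + b ∈ sumset A B
∈-sumset⁺ {a} A B a∈A b∈B = ∈-concatMap⁺ (λ a′ → map (a′ +_) B) (lose a∈A (∈-map⁺ (a +_) b∈B))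

∈-sumset⁻ : ∀ {x} A B → x ∈ sumset A B → ∃ λ a → ∃ λ b → a ∈ A × b ∈ B × x ≡ a + b
∈-sumset⁻ A B x∈ with find (∈-concatMap⁻ (λ a′ → map (a′ +_) B) x∈)
... | a , a∈A , x∈aB with ∈-map⁻ (a +_) x∈aB
... | b , b∈B , x≡a+b = a , b , a∈A , b∈B , x≡a+b

card-sumset-comm : ∀ A B → card (sumset A B) ≡ card (sumset B A)
card-sumset-comm A B = ≤-antisym (card-mono _ _ (swap A B)) (card-mono _ _ (swap B A))
  where
    swap : ∀ X Y {z} → z ∈ sumset X Y → z ∈ sumset Y X
    swap X Y z∈ with ∈-sumset⁻ X Y z∈
    ... | a , b , a∈ , b∈ , refl = subst (_∈ sumset Y X) (+-comm b a) (∈-sumset⁺ Y X b∈ a∈)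

two-members : ∀ A → 2 ≤ card A → ∃ λ a₁ → ∃ λ a₂ → a₁ ∈ A × a₂ ∈ A × a₁ < a₂
two-members A 2≤ = go (deduplicate _≟_ A) (deduplicate-! A) (∈-deduplicate⁻ _≟_ A) 2≤
  where
    go : ∀ D → Unique D → (∀ {z} → z ∈ D → z ∈ A) → 2 ≤ length D →
         ∃ λ a₁ → ∃ λ a₂ → a₁ ∈ A × a₂ ∈ A × a₁ < a₂
    go (x ∷ []) _ _ (s≤s ())
    go (x ∷ y ∷ _) ((x≢y ∷ _) ∷ _) D⊆A _ with <-cmp x y
    ... | tri< x<y _ _ = x , y , D⊆A (here refl) , D⊆A (there (here refl)) , x<y
    ... | tri≈ _ x≡y _ = ⊥-elim (x≢y x≡y)
    ... | tri> _ _ y<x = y , x , D⊆A (there (here refl)) , D⊆A (here refl) , y<x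

largest-member : ∀ B → B ≢ [] → ∃ λ m → m ∈ B × (∀ {b} → b ∈ B → b ≤ m)
largest-member [] B≢[] = ⊥-elim (B≢[] refl)
largest-member (b ∷ bs) _ = Extrema.max b bs , max∈ , bounded
  where
    max∈ : Extrema.max b bs ∈ b ∷ bs
    max∈ with Extrema.argmax-sel (λ x → x) b bs
    ... | inj₁ eq = here eq
    ... | inj₂ m∈bs = there m∈bs
    bounded : ∀ {x} → x ∈ b ∷ bs → x ≤ Extrema.max b bs
    bounded (here refl) = Extrema.⊥≤max b bs
    bounded (there x∈) = All.lookup (Extrema.xs≤max b bs) x∈

-- Adding a set with two members strictly enlarges a non-empty set B:
-- a₁ + B together with a₂ + max B are card B + 1 distinct sums.
sumset-grows : ∀ A B → 2 ≤ card A → B ≢ [] → suc (card B) ≤ card (sumset A B)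
sumset-grows A B 2≤A B≢[] with two-members A 2≤A | largest-member B B≢[]
... | a₁ , a₂ , a₁∈ , a₂∈ , a₁<a₂ | m , m∈ , ≤m =
  subst (_≤ card (sumset A B)) (cong suc (length-map (a₁ +_) DB))
    (unique-⊆-length L _ unique-L (λ z∈ → ∈-deduplicate⁺ _≟_ (L⊆ z∈)))
  where
    DB L : List ℕ
    DB = deduplicate _≟_ B
    L = (a₂ + m) ∷ map (a₁ +_) DB
    top-new : ∀ {y} → y ∈ map (a₁ +_) DB → a₂ + m ≢ y
    top-new y∈ eq with ∈-map⁻ (a₁ +_) y∈
    ... | b , b∈ , refl = <-irrefl (sym eq) (+-mono-<-≤ a₁<a₂ (≤m (∈-deduplicate⁻ _≟_ B b∈)))
    unique-L : Unique L
    unique-L = All.tabulate top-new ∷ map⁺ (+-cancelˡ-≡ a₁ _ _) (deduplicate-! B)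
    L⊆ : ∀ {z} → z ∈ L → z ∈ sumset A B
    L⊆ (here refl) = ∈-sumset⁺ A B a₂∈ m∈
    L⊆ (there z∈) with ∈-map⁻ (a₁ +_) z∈
    ... | b , b∈ , refl = ∈-sumset⁺ A B a₁∈ (∈-deduplicate⁻ _≟_ B b∈)

weak-sum-has-singleton : ∀ A B → A ≢ [] → B ≢ [] → card (sumset A B) ≡ card A ⊔ card B →
  2 ≤ card A → 2 ≤ card B → ⊥
weak-sum-has-singleton A B A≢[] B≢[] weak 2≤A 2≤B with ⊔-sel (card A) (card B)
... | inj₁ max≡A = <-irrefl refl (subst (suc (card A) ≤_) (trans (card-sumset-comm B A) (trans weak max≡A))
                     (sumset-grows B A 2≤B A≢[]))
... | inj₂ max≡B = <-irrefl refl (subst (suc (card B) ≤_) (trans weak max≡B) (sumset-grows A B 2≤A B≢[]))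

card-pos : ∀ A → A ≢ [] → 1 ≤ card A
card-pos [] A≢[] = ⊥-elim (A≢[] refl)
card-pos (_ ∷ _) _ = s≤s z≤n

module Mono {N : ℕ} {adj : Adj N} (g : WeakIASI N adj) where
  open WeakIASI g

  mono : Fin N → Bool
  mono v = card (f v) ≡ᵇ 1

  private
    two≤ : ∀ c → 1 ≤ c → (c ≡ᵇ 1) ≡ false → 2 ≤ c
    two≤ (suc (suc c)) _ _ = s≤s (s≤s z≤n)

    max≡1 : ∀ a b → 1 ≤ a → 1 ≤ b → (a ⊔ b ≡ᵇ 1) ≡ (a ≡ᵇ 1) ∧ (b ≡ᵇ 1)
    max≡1 (suc zero) (suc zero) _ _ = refl
    max≡1 (suc zero) (suc (suc b)) _ _ = refl
    max≡1 (suc (suc a)) (suc zero) _ _ = refl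
    max≡1 (suc (suc a)) (suc (suc b)) _ _ = refl

  mono-cover : ∀ u v → adj u v ≡ true → mono u ∨ mono v ≡ true
  mono-cover u v uv with mono u in mu | mono v in mv
  ... | true | _ = refl
  ... | false | true = refl
  ... | false | false = ⊥-elim (weak-sum-has-singleton (f u) (f v) (nonempty u) (nonempty v) (weak u v uv)
          (two≤ _ (card-pos (f u) (nonempty u)) mu) (two≤ _ (card-pos (f v) (nonempty v)) mv))

  edge-mono : ∀ u v → adj u v ≡ true → (card (sumset (f u) (f v)) ≡ᵇ 1) ≡ mono u ∧ mono v
  edge-mono u v uv rewrite weak u v uv = max≡1 _ _ (card-pos (f u) (nonempty u)) (card-pos (f v) (nonempty v))

  spared : ℕ
  spared = ∑[ v < N ] (ind (not (mono v)) * degree adj v)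

  -- Every edge not mono-indexed is incident to exactly one spared vertex, so
  -- 2·(mono-indexed edges) + 2·spared = 2·(all edges).
  mono-handshake : Symmetric adj → Loopless adj →
    monoEdges g * 2 + 2 * spared ≡ ∑[ v < N ] degree adj v
  mono-handshake sym-adj loopless = begin
    monoEdges g * 2 + 2 * spared
      ≡⟨ cong (λ x → x * 2 + 2 * spared) (trans (count-pairs N _) (sum-cong N (λ i → sum-cong N (ordered i)))) ⟩
    (∑[ i < N ] ∑[ j < N ] ind ((toℕ i <ᵇ toℕ j) ∧ h i j)) * 2 + 2 * spared
      ≡⟨ cong (_+ 2 * spared) (count-unordered N h sym-h (λ i j hij → loopless i j (proj₁ (∧-true⁻ hij)))) ⟩
    ∑[ i < N ] ∑[ j < N ] ind (h i j) + 2 * spared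
      ≡⟨ handshake-cover N adj mono sym-adj mono-cover ⟩
    ∑[ v < N ] degree adj v ∎
    where
      open ≡-Reasoning
      h : Fin N → Fin N → Bool
      h i j = adj i j ∧ (mono i ∧ mono j)
      sym-h : Symmetric h
      sym-h i j = cong₂ _∧_ (sym-adj i j) (∧-comm (mono i) (mono j))
      ordered : ∀ i j → ind ((toℕ i <ᵇ toℕ j) ∧ (adj i j ∧ (card (sumset (f i) (f j)) ≡ᵇ 1)))
                      ≡ ind ((toℕ i <ᵇ toℕ j) ∧ h i j)
      ordered i j with adj i j in ij
      ... | true = cong (λ x → ind ((toℕ i <ᵇ toℕ j) ∧ x)) (edge-mono i j ij)
      ... | false = refl

sparing-number : ∀ {N} {adj : Adj N} → Symmetric adj → Loopless adj → (s v : ℕ) →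
  (∀ g → Mono.spared g ≤ s) → (g₀ : WeakIASI N adj) → Mono.spared g₀ ≡ s →
  v * 2 + 2 * s ≡ ∑[ u < N ] degree adj u → IsSparingNumber N adj v
sparing-number sym-adj loopless s v bound g₀ spared≡s total =
  (g₀ , *-cancelʳ-≡ _ _ 2 (+-cancelʳ-≡ (2 * s) _ _ attained)) , minimal
  where
    attained : monoEdges g₀ * 2 + 2 * s ≡ v * 2 + 2 * s
    attained = trans (subst (λ x → monoEdges g₀ * 2 + 2 * x ≡ _) spared≡s (Mono.mono-handshake g₀ sym-adj loopless))
                     (sym total)
    minimal : ∀ g → v ≤ monoEdges g
    minimal g = *-cancelʳ-≤ v (monoEdges g) 2 (+-cancelʳ-≤ (2 * s) _ _
      (subst (_≤ monoEdges g * 2 + 2 * s) (sym total)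
        (subst (_≤ monoEdges g * 2 + 2 * s) (Mono.mono-handshake g sym-adj loopless)
          (+-monoʳ-≤ (monoEdges g * 2) (*-monoʳ-≤ 2 (bound g))))))

any-intro : ∀ {N} (p : Fin N → Bool) z → p z ≡ true → any p (allFin N) ≡ true
any-intro p z pz = Equivalence.to T-≡ (any⁺ p (lose (∈-allFin z) (Equivalence.from T-≡ pz)))

any-elim : ∀ {N} (p : Fin N → Bool) → any p (allFin N) ≡ true → ∃ λ z → p z ≡ true
any-elim {N} p any-p with find (any⁻ p (allFin N) (Equivalence.from T-≡ any-p))
... | z , _ , pz = z , Equivalence.to T-≡ pz

module _ {N : ℕ} (adj : Adj N) where

  square-edge : ∀ x y → toℕ x ≢ toℕ y → adj x y ≡ true → square adj x y ≡ true
  square-edge x y x≢y xy = ∧-true⁺ (≢⇒not-≡ᵇ x≢y) (∨-trueˡ xy)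

  square-path : ∀ x z y → toℕ x ≢ toℕ y → adj x z ≡ true → adj z y ≡ true → square adj x y ≡ true
  square-path x z y x≢y xz zy =
    ∧-true⁺ (≢⇒not-≡ᵇ x≢y) (∨-trueʳ (any-intro (λ k → adj x k ∧ adj k y) z (∧-true⁺ xz zy)))

  square-elim : ∀ x y → square adj x y ≡ true →
    toℕ x ≢ toℕ y × (adj x y ≡ true ⊎ ∃ λ z → adj x z ≡ true × adj z y ≡ true)
  square-elim x y sq with ∧-true⁻ {not (finEq x y)} sq
  ... | x≢y , reach = not-≡ᵇ⇒≢ x≢y , paths (∨-true⁻ reach)
    where
      paths : adj x y ≡ true ⊎ any (λ k → adj x k ∧ adj k y) (allFin N) ≡ true →
              adj x y ≡ true ⊎ ∃ λ z → adj x z ≡ true × adj z y ≡ true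
      paths (inj₁ xy) = inj₁ xy
      paths (inj₂ via) with any-elim _ via
      ... | z , xzy = inj₂ (z , ∧-true⁻ xzy)

  square-loopless : Loopless (square adj)
  square-loopless x y sq = proj₁ (square-elim x y sq)

  square-sym : Symmetric adj → Symmetric (square adj)
  square-sym sym-adj x y = bool-ext (flip x y) (flip y x)
    where
      flip : ∀ a b → square adj a b ≡ true → square adj b a ≡ true
      flip a b sq with square-elim a b sq
      ... | a≢b , inj₁ ab = square-edge b a (a≢b ∘ sym) (trans (sym-adj b a) ab)
      ... | a≢b , inj₂ (z , az , zb) = square-path b z a (a≢b ∘ sym) (trans (sym-adj b z) zb) (trans (sym-adj z a) az)

prv : ℕ → ℕ → ℕ
prv n zero = pred n
prv n (suc a) = a

nxt : ℕ → ℕ → ℕ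
nxt n a = if suc a ≡ᵇ n then 0 else suc a

module _ {n : ℕ} where

  nxt-< : ∀ {a} → a < n → nxt n a < n
  nxt-< {a} a<n with suc a ≡ᵇ n in eq
  ... | true = ≤-trans (s≤s z≤n) a<n
  ... | false = ≤∧≢⇒< a<n (λ e → false≢true (trans (sym eq) (≡⇒≡ᵇ′ e)))

  prv-< : ∀ {a} → a < n → prv n a < n
  prv-< {zero} (s≤s _) = n<1+n _
  prv-< {suc a} a<n = <⇒≤ a<n

  prv-nxt : ∀ {a} → a < n → prv n (nxt n a) ≡ a
  prv-nxt {a} a<n with suc a ≡ᵇ n in eq
  ... | true = cong pred (sym (≡ᵇ⇒≡′ {suc a} {n} eq))
  ... | false = refl

  nxt-prv : ∀ {a} → a < n → nxt n (prv n a) ≡ a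
  nxt-prv {zero} (s≤s {n = m} _) with suc m ≡ᵇ suc m in eq
  ... | true = refl
  ... | false = ⊥-elim (false≢true (trans (sym eq) (≡⇒≡ᵇ′ {suc m} refl)))
  nxt-prv {suc a} a<n with suc a ≡ᵇ n in eq
  ... | true = ⊥-elim (<-irrefl (≡ᵇ⇒≡′ eq) a<n)
  ... | false = refl

  prv-≢ : 2 ≤ n → ∀ {a} → a < n → prv n a ≢ a
  prv-≢ (s≤s (s≤s _)) {zero} _ ()
  prv-≢ _ {suc a} _ e = <-irrefl e (n<1+n a)

  nxt-≢ : 2 ≤ n → ∀ {a} → a < n → nxt n a ≢ a
  nxt-≢ 2≤n a<n e = prv-≢ 2≤n a<n (trans (cong (prv n) (sym e)) (prv-nxt a<n))

  nxt-≢-prv : 3 ≤ n → ∀ {a} → a < n → nxt n a ≢ prv n a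
  nxt-≢-prv 3≤n {a} a<n with suc a ≡ᵇ n in eq
  nxt-≢-prv 3≤n {zero} _ | true = λ _ → <⇒≢ (<⇒≤ 3≤n) (≡ᵇ⇒≡′ eq)
  nxt-≢-prv 3≤n {suc zero} _ | true = λ _ → <⇒≢ 3≤n (≡ᵇ⇒≡′ eq)
  nxt-≢-prv _ {suc (suc a)} _ | true = λ ()
  nxt-≢-prv (s≤s 2≤pred-n) {zero} _ | false = <⇒≢ 2≤pred-n
  nxt-≢-prv _ {suc a} _ | false = λ e → <-irrefl (sym e) (≤-trans (n<1+n a) (n≤1+n (suc a)))

  -- In the complete sun, w_a is adjacent exactly to u_a and u_(a-1): the Boolean
  -- below is wuAdj n j i of Defs with a = toℕ j and b = toℕ i.
  incident⁻ : ∀ a b → ((a ≡ᵇ b) ∨ (a ≡ᵇ suc b) ∨ ((a ≡ᵇ 0) ∧ (suc b ≡ᵇ n))) ≡ true →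
    b ≡ a ⊎ b ≡ prv n a
  incident⁻ a b ab with ∨-true⁻ {a ≡ᵇ b} ab
  ... | inj₁ a≡b = inj₁ (sym (≡ᵇ⇒≡′ a≡b))
  ... | inj₂ rest with ∨-true⁻ {a ≡ᵇ suc b} rest
  ...   | inj₁ a≡1+b rewrite ≡ᵇ⇒≡′ {a} a≡1+b = inj₂ refl
  ...   | inj₂ wrap with ∧-true⁻ {a ≡ᵇ 0} wrap
  ...     | a≡0 , 1+b≡n rewrite ≡ᵇ⇒≡′ {a} a≡0 = inj₂ (cong pred (≡ᵇ⇒≡′ {suc b} {n} 1+b≡n))

  incident⁺ : ∀ {a} b → a < n → b ≡ a ⊎ b ≡ prv n a →
    ((a ≡ᵇ b) ∨ (a ≡ᵇ suc b) ∨ ((a ≡ᵇ 0) ∧ (suc b ≡ᵇ n))) ≡ true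
  incident⁺ b _ (inj₁ refl) = ∨-trueˡ (≡⇒≡ᵇ′ {b} refl)
  incident⁺ {zero} b (s≤s _) (inj₂ refl) = ∨-trueʳ {zero ≡ᵇ b} (∨-trueʳ {zero ≡ᵇ suc b} (≡⇒≡ᵇ′ {suc b} refl))
  incident⁺ {suc a} b _ (inj₂ refl) = ∨-trueʳ {suc a ≡ᵇ a} (∨-trueˡ (≡⇒≡ᵇ′ {a} refl))

  common-neighbour : ∀ {a b i} → a < n → b < n → a ≢ b →
    i ≡ a ⊎ i ≡ prv n a → i ≡ b ⊎ i ≡ prv n b → b ≡ nxt n a ⊎ b ≡ prv n a
  common-neighbour _ _ a≢b (inj₁ refl) (inj₁ refl) = ⊥-elim (a≢b refl)
  common-neighbour _ b<n _ (inj₁ refl) (inj₂ refl) = inj₁ (sym (nxt-prv b<n))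
  common-neighbour _ _ _ (inj₂ refl) (inj₁ refl) = inj₂ refl
  common-neighbour a<n b<n a≢b (inj₂ refl) (inj₂ p≡p) =
    ⊥-elim (a≢b (trans (sym (nxt-prv a<n)) (trans (cong (nxt n) p≡p) (nxt-prv b<n))))

module SunSquare (n : ℕ) where

  sun G² : Adj (n + n)
  sun = completeSun n
  G² = square sun

  u w : Fin n → Fin (n + n)
  u i = i ↑ˡ n
  w j = n ↑ʳ j

  vertex-cases : ∀ x → (∃ λ i → u i ≡ x) ⊎ (∃ λ j → w j ≡ x)
  vertex-cases x with splitAt n x in eq
  ... | inj₁ i = inj₁ (i , splitAt⁻¹-↑ˡ eq)
  ... | inj₂ j = inj₂ (j , splitAt⁻¹-↑ʳ eq)

  sun-uu : ∀ i k → sun (u i) (u k) ≡ not (toℕ i ≡ᵇ toℕ k)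
  sun-uu i k rewrite splitAt-↑ˡ n i n | splitAt-↑ˡ n k n = refl

  sun-uw : ∀ i j → sun (u i) (w j) ≡ wuAdj n j i
  sun-uw i j rewrite splitAt-↑ˡ n i n | splitAt-↑ʳ n n j = refl

  sun-wu : ∀ j i → sun (w j) (u i) ≡ wuAdj n j i
  sun-wu j i rewrite splitAt-↑ˡ n i n | splitAt-↑ʳ n n j = refl

  sun-ww : ∀ j k → sun (w j) (w k) ≡ false
  sun-ww j k rewrite splitAt-↑ʳ n n j | splitAt-↑ʳ n n k = refl

  sun-sym : Symmetric sun
  sun-sym x y with vertex-cases x | vertex-cases y
  ... | inj₁ (i , refl) | inj₁ (k , refl) =
    trans (sun-uu i k) (trans (cong not (≡ᵇ-sym (toℕ i) (toℕ k))) (sym (sun-uu k i)))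
  ... | inj₁ (i , refl) | inj₂ (k , refl) = trans (sun-uw i k) (sym (sun-wu k i))
  ... | inj₂ (j , refl) | inj₁ (k , refl) = trans (sun-wu j k) (sym (sun-uw k j))
  ... | inj₂ (j , refl) | inj₂ (k , refl) = trans (sun-ww j k) (sym (sun-ww k j))

  G²-sym : Symmetric G²
  G²-sym = square-sym sun sun-sym

  G²-loopless : Loopless G²
  G²-loopless = square-loopless sun

  u≢u : ∀ {i k} → toℕ i ≢ toℕ k → toℕ (u i) ≢ toℕ (u k)
  u≢u {i} {k} i≢k e = i≢k (trans (sym (toℕ-↑ˡ i n)) (trans e (toℕ-↑ˡ k n)))

  w-cong : ∀ {j k} → toℕ j ≡ toℕ k → toℕ (w j) ≡ toℕ (w k)
  w-cong {j} {k} j≡k = trans (toℕ-↑ʳ n j) (trans (cong (n +_) j≡k) (sym (toℕ-↑ʳ n k)))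

  w≢w : ∀ {j k} → toℕ j ≢ toℕ k → toℕ (w j) ≢ toℕ (w k)
  w≢w {j} {k} j≢k e = j≢k (+-cancelˡ-≡ n _ _ (trans (sym (toℕ-↑ʳ n j)) (trans e (toℕ-↑ʳ n k))))

  u≢w : ∀ i j → toℕ (u i) ≢ toℕ (w j)
  u≢w i j e = <⇒≱ (toℕ<n i) (subst (n ≤_) (sym (trans (sym (toℕ-↑ˡ i n)) (trans e (toℕ-↑ʳ n j))))
                                          (m≤m+n n (toℕ j)))

  G²-uu : ∀ i k → G² (u i) (u k) ≡ not (toℕ i ≡ᵇ toℕ k)
  G²-uu i k = bool-ext
    (λ sq → ≢⇒not-≡ᵇ (λ e → proj₁ (square-elim sun (u i) (u k) sq) (trans (toℕ-↑ˡ i n) (trans e (sym (toℕ-↑ˡ k n))))))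
    (λ i≢k → square-edge sun (u i) (u k) (u≢u (not-≡ᵇ⇒≢ i≢k)) (trans (sun-uu i k) i≢k))

  -- Every u_i reaches every w_j: directly, or through u_j.
  G²-uw : ∀ i j → G² (u i) (w j) ≡ true
  G²-uw i j with toℕ i ≟ toℕ j
  ... | yes i≡j = square-edge sun (u i) (w j) (u≢w i j)
                    (trans (sun-uw i j) (incident⁺ (toℕ i) (toℕ<n j) (inj₁ i≡j)))
  ... | no i≢j = square-path sun (u i) (u j) (w j) (u≢w i j)
                   (trans (sun-uu i j) (≢⇒not-≡ᵇ i≢j))
                   (trans (sun-uw j j) (incident⁺ (toℕ j) (toℕ<n j) (inj₁ refl)))

  G²-wu : ∀ j i → G² (w j) (u i) ≡ true
  G²-wu j i = trans (G²-sym (w j) (u i)) (G²-uw i j)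

  -- W induces the cycle ℤ_n in G²: w_j and w_k are adjacent iff k = j ± 1,
  -- because their only possible common neighbours are u_j, u_(j-1), u_k, u_(k-1).
  cyclic : Fin n → Fin n → Bool
  cyclic j k = (toℕ k ≡ᵇ nxt n (toℕ j)) ∨ (toℕ k ≡ᵇ prv n (toℕ j))

  G²-ww⇒cyclic : ∀ j k → G² (w j) (w k) ≡ true → cyclic j k ≡ true
  G²-ww⇒cyclic j k sq with square-elim sun (w j) (w k) sq
  ... | _ , inj₁ direct = ⊥-elim (false≢true (trans (sym (sun-ww j k)) direct))
  ... | wj≢wk , inj₂ (z , jz , zk) with vertex-cases z
  ...   | inj₂ (i , refl) = ⊥-elim (false≢true (trans (sym (sun-ww j i)) jz))
  ...   | inj₁ (i , refl)
          with common-neighbour (toℕ<n j) (toℕ<n k) (λ j≡k → wj≢wk (w-cong j≡k))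
                 (incident⁻ (toℕ j) (toℕ i) (trans (sym (sun-wu j i)) jz))
                 (incident⁻ (toℕ k) (toℕ i) (trans (sym (sun-uw i k)) zk))
  ...     | inj₁ k≡nxt = ∨-trueˡ (≡⇒≡ᵇ′ k≡nxt)
  ...     | inj₂ k≡prv = ∨-trueʳ {toℕ k ≡ᵇ nxt n (toℕ j)} (≡⇒≡ᵇ′ k≡prv)

  cyclic⇒G²-ww : 2 ≤ n → ∀ j k → cyclic j k ≡ true → G² (w j) (w k) ≡ true
  cyclic⇒G²-ww 2≤n j k nbr with ∨-true⁻ {toℕ k ≡ᵇ nxt n (toℕ j)} nbr
  ... | inj₁ is-nxt = square-path sun (w j) (u j) (w k)
          (w≢w (λ j≡k → nxt-≢ 2≤n j<n (sym (trans j≡k k≡nxt))))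
          (trans (sun-wu j j) (incident⁺ (toℕ j) j<n (inj₁ refl)))
          (trans (sun-uw j k) (incident⁺ (toℕ j) k<n (inj₂ (trans (sym (prv-nxt j<n)) (cong (prv n) (sym k≡nxt))))))
    where
      j<n : toℕ j < n
      j<n = toℕ<n j
      k<n : toℕ k < n
      k<n = toℕ<n k
      k≡nxt : toℕ k ≡ nxt n (toℕ j)
      k≡nxt = ≡ᵇ⇒≡′ {toℕ k} is-nxt
  ... | inj₂ is-prv = square-path sun (w j) (u k) (w k)
          (w≢w (λ j≡k → prv-≢ 2≤n j<n (sym (trans j≡k k≡prv))))
          (trans (sun-wu j k) (incident⁺ (toℕ k) j<n (inj₂ k≡prv)))
          (trans (sun-uw k k) (incident⁺ (toℕ k) k<n (inj₁ refl)))
    where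
      j<n : toℕ j < n
      j<n = toℕ<n j
      k<n : toℕ k < n
      k<n = toℕ<n k
      k≡prv : toℕ k ≡ prv n (toℕ j)
      k≡prv = ≡ᵇ⇒≡′ {toℕ k} is-prv

  G²-ww : 2 ≤ n → ∀ j k → G² (w j) (w k) ≡ cyclic j k
  G²-ww 2≤n j k = bool-ext (G²-ww⇒cyclic j k) (cyclic⇒G²-ww 2≤n j k)

  sum-ones : ∑[ i < n ] 1 ≡ n
  sum-ones = trans (sum-const n 1) (*-identityʳ n)

  degree-u : ∀ i → degree G² (u i) ≡ n ∸ 1 + n
  degree-u i = begin
    degree G² (u i)                                                  ≡⟨ sum-split n n _ ⟩
    ∑[ k < n ] ind (G² (u i) (u k)) + ∑[ j < n ] ind (G² (u i) (w j)) ≡⟨ cong₂ _+_ in-U in-W ⟩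
    n ∸ 1 + n                                                        ∎
    where
      open ≡-Reasoning
      others+self : ∑[ k < n ] ind (not (toℕ i ≡ᵇ toℕ k)) + 1 ≡ n
      others+self = begin
        ∑[ k < n ] ind (not (toℕ i ≡ᵇ toℕ k)) + 1
          ≡⟨ cong (∑[ k < n ] ind (not (toℕ i ≡ᵇ toℕ k)) +_) (sym (trans (sum-cong n (λ k → cong ind (≡ᵇ-sym (toℕ i) (toℕ k)))) (count-index-< (toℕ<n i)))) ⟩
        ∑[ k < n ] ind (not (toℕ i ≡ᵇ toℕ k)) + ∑[ k < n ] ind (toℕ i ≡ᵇ toℕ k)
          ≡⟨ sym (sum-+ n _ _) ⟩
        ∑[ k < n ] (ind (not (toℕ i ≡ᵇ toℕ k)) + ind (toℕ i ≡ᵇ toℕ k))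
          ≡⟨ trans (sum-cong n (λ k → ind-not (toℕ i ≡ᵇ toℕ k))) sum-ones ⟩
        n ∎
      in-U : ∑[ k < n ] ind (G² (u i) (u k)) ≡ n ∸ 1
      in-U = trans (sum-cong n (λ k → cong ind (G²-uu i k)))
                   (trans (sym (m+n∸n≡m _ 1)) (cong (_∸ 1) others+self))
      in-W : ∑[ j < n ] ind (G² (u i) (w j)) ≡ n
      in-W = trans (sum-cong n (λ j → cong ind (G²-uw i j))) sum-ones

  cycle-degree : 3 ≤ n → ∀ j → ∑[ k < n ] ind (G² (w j) (w k)) ≡ 2
  cycle-degree 3≤n j = begin
    ∑[ k < n ] ind (G² (w j) (w k))                                        ≡⟨ sum-cong n (λ k → cong ind (G²-ww (<⇒≤ 3≤n) j k)) ⟩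
    ∑[ k < n ] ind ((toℕ k ≡ᵇ nxt n a) ∨ (toℕ k ≡ᵇ prv n a))               ≡⟨ sum-cong n (λ k → ind-∨ _ _ (exclusive k)) ⟩
    ∑[ k < n ] (ind (toℕ k ≡ᵇ nxt n a) + ind (toℕ k ≡ᵇ prv n a))            ≡⟨ sum-+ n _ _ ⟩
    ∑[ k < n ] ind (toℕ k ≡ᵇ nxt n a) + ∑[ k < n ] ind (toℕ k ≡ᵇ prv n a)   ≡⟨ cong₂ _+_ (count-index-< (nxt-< a<n)) (count-index-< (prv-< a<n)) ⟩
    2                                                                    ∎
    where
      open ≡-Reasoning
      a : ℕ
      a = toℕ j
      a<n : a < n
      a<n = toℕ<n j
      exclusive : ∀ k → (toℕ k ≡ᵇ nxt n a) ≡ true → (toℕ k ≡ᵇ prv n a) ≡ true → ⊥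
      exclusive k is-nxt is-prv = nxt-≢-prv 3≤n a<n (trans (sym (≡ᵇ⇒≡′ {toℕ k} is-nxt)) (≡ᵇ⇒≡′ is-prv))

  degree-w : 3 ≤ n → ∀ j → degree G² (w j) ≡ n + 2
  degree-w 3≤n j = trans (sum-split n n _)
    (cong₂ _+_ (trans (sum-cong n (λ i → cong ind (G²-wu j i))) sum-ones) (cycle-degree 3≤n j))

  total-degree : 3 ≤ n → ∑[ x < n + n ] degree G² x ≡ n * (n ∸ 1 + n) + n * (n + 2)
  total-degree 3≤n = trans (sum-split n n _)
    (cong₂ _+_ (trans (sum-cong n degree-u) (sum-const n _)) (trans (sum-cong n (degree-w 3≤n)) (sum-const n _)))

degree-u≤half-W : ∀ n → 3 ≤ n → n ∸ 1 + n ≤ (n / 2) * (n + 2)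
degree-u≤half-W 1 (s≤s ())
degree-u≤half-W 2 (s≤s (s≤s ()))
degree-u≤half-W 3 _ = ≤-refl
degree-u≤half-W n@(suc (suc (suc (suc t)))) _ =
  ≤-trans (subst (3 + t + n ≤_) (twice t) (m≤m+n _ 5)) (*-monoˡ-≤ (n + 2) (/-monoˡ-≤ 2 (s≤s (s≤s (s≤s (s≤s (z≤n {t})))))))
  where
    twice : ∀ t → 3 + t + (4 + t) + 5 ≡ 2 * (4 + t + 2)
    twice = solve-∀

module SparedBound (n : ℕ) (3≤n : 3 ≤ n) (g : WeakIASI (n + n) (SunSquare.G² n)) where
  open SunSquare n
  open Mono g

  spared-U spared-W : ℕ
  spared-U = ∑[ i < n ] ind (not (mono (u i)))
  spared-W = ∑[ j < n ] ind (not (mono (w j)))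

  spared-split : spared ≡ spared-U * (n ∸ 1 + n) + spared-W * (n + 2)
  spared-split = trans (sum-split n n _) (cong₂ _+_
    (trans (sum-cong n (λ i → cong (ind (not (mono (u i))) *_) (degree-u i))) (sum-*ʳ n _ _))
    (trans (sum-cong n (λ j → cong (ind (not (mono (w j))) *_) (degree-w 3≤n j))) (sum-*ʳ n _ _)))

  -- The mono-indexed vertices of W cover the cycle W, whose vertices have
  -- degree 2, so (handshake) at most half of W is spared.
  W-spared≤half : spared-W ≤ n / 2
  W-spared≤half = subst (_≤ n / 2) (m*n/n≡m spared-W 2) (/-monoˡ-≤ 2 (*-cancelʳ-≤ (spared-W * 2) n 2 four-b≤2n))
    where
      cycle : Fin n → Fin n → Bool
      cycle j k = G² (w j) (w k)
      inside spared-cycle : ℕ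
      inside = ∑[ j < n ] ∑[ k < n ] ind (cycle j k ∧ (mono (w j) ∧ mono (w k)))
      spared-cycle = ∑[ j < n ] (ind (not (mono (w j))) * degree cycle j)
      handshake : inside + 2 * spared-cycle ≡ ∑[ j < n ] degree cycle j
      handshake = handshake-cover n cycle (λ j → mono (w j)) (λ j k → G²-sym (w j) (w k)) (λ j k → mono-cover (w j) (w k))
      four-b≤2n : spared-W * 2 * 2 ≤ n * 2
      four-b≤2n = begin
        spared-W * 2 * 2          ≡⟨ *-comm (spared-W * 2) 2 ⟩
        2 * (spared-W * 2)        ≡⟨ cong (2 *_) (sym (trans (sum-cong n (λ j → cong (ind (not (mono (w j))) *_) (cycle-degree 3≤n j))) (sum-*ʳ n _ 2))) ⟩
        2 * spared-cycle          ≤⟨ m≤n+m _ inside ⟩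
        inside + 2 * spared-cycle ≡⟨ handshake ⟩
        ∑[ j < n ] degree cycle j ≡⟨ trans (sum-cong n (cycle-degree 3≤n)) (sum-const n 2) ⟩
        n * 2                     ∎
        where open ≤-Reasoning

  -- A spared vertex u_i of U is adjacent to every other vertex, so all
  -- others are mono-indexed.
  U-spared : ∀ i → mono (u i) ≡ false → spared-U ≤ 1 × spared-W ≡ 0
  U-spared i u-spared = U-at-most-one , W-none
    where
      w-mono : ∀ j → mono (w j) ≡ true
      w-mono j with mono-cover (u i) (w j) (G²-uw i j)
      ... | cover rewrite u-spared = cover
      W-none : spared-W ≡ 0
      W-none = trans (sum-cong n (λ j → cong (ind ∘ not) (w-mono j))) (sum-zero n)
      only-i : ∀ k → ind (not (mono (u k))) ≤ ind (toℕ k ≡ᵇ toℕ i)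
      only-i k with toℕ k ≡ᵇ toℕ i in k≟i
      ... | true = ind≤1 _
      ... | false with mono-cover (u i) (u k) (trans (G²-uu i k) (trans (cong not (≡ᵇ-sym (toℕ i) (toℕ k))) (cong not k≟i)))
      ...   | cover rewrite u-spared | cover = z≤n
      U-at-most-one : spared-U ≤ 1
      U-at-most-one = ≤-trans (sum-mono n only-i) (≤-reflexive (count-index-< (toℕ<n i)))

  spared-bound : spared ≤ (n / 2) * (n + 2)
  spared-bound with spared-U ≟ 0
  ... | yes none = subst (_≤ (n / 2) * (n + 2)) (sym (trans spared-split (cong (λ a → a * (n ∸ 1 + n) + spared-W * (n + 2)) none)))
                     (*-monoˡ-≤ (n + 2) W-spared≤half)
  ... | no some with count-witness n (λ i → not (mono (u i))) some
  ...   | i , not-mono with U-spared i (not-true⁻ not-mono)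
  ...     | U≤1 , W≡0 = ≤-trans (≤-reflexive spared-split) (≤-trans bound (degree-u≤half-W n 3≤n))
    where
      bound : spared-U * (n ∸ 1 + n) + spared-W * (n + 2) ≤ n ∸ 1 + n
      bound rewrite W≡0 | +-identityʳ (spared-U * (n ∸ 1 + n)) = ≤-trans (*-monoˡ-≤ (n ∸ 1 + n) U≤1) (≤-reflexive (*-identityˡ _))

2^-injective : ∀ {a b} → 2 ^ a ≡ 2 ^ b → a ≡ b
2^-injective {a} {b} e = trans (sym (⌊log₂[2^n]⌋≡n a)) (trans (cong ⌊log₂_⌋ e) (⌊log₂[2^n]⌋≡n b))

-- For a < b the smaller exponent is recovered from parity, the larger one after halving.
powers-ordered : ∀ a b c d → a < b → c < d → 2 ^ a + 2 ^ b ≡ 2 ^ c + 2 ^ d → a ≡ c × b ≡ d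
powers-ordered zero b zero d _ _ e = refl , 2^-injective (+-cancelˡ-≡ 1 _ _ e)
powers-ordered zero (suc b) (suc c) (suc d) _ _ e =
  ⊥-elim (even≢odd (2 ^ c + 2 ^ d) (2 ^ b) (sym (trans e (sym (*-distribˡ-+ 2 (2 ^ c) (2 ^ d))))))
powers-ordered (suc a) (suc b) zero (suc d) _ _ e =
  ⊥-elim (even≢odd (2 ^ a + 2 ^ b) (2 ^ d) (trans (*-distribˡ-+ 2 (2 ^ a) (2 ^ b)) e))
powers-ordered (suc a) (suc b) (suc c) (suc d) (s≤s a<b) (s≤s c<d) e with powers-ordered a b c d a<b c<d
    (*-cancelˡ-≡ _ _ 2 (trans (*-distribˡ-+ 2 (2 ^ a) (2 ^ b)) (trans e (sym (*-distribˡ-+ 2 (2 ^ c) (2 ^ d))))))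
... | a≡c , b≡d = cong suc a≡c , cong suc b≡d

powers-unique : ∀ a b c d → a ≢ b → c ≢ d → 2 ^ a + 2 ^ b ≡ 2 ^ c + 2 ^ d →
  (a ≡ c × b ≡ d) ⊎ (a ≡ d × b ≡ c)
powers-unique a b c d a≢b c≢d e with <-cmp a b | <-cmp c d
... | tri≈ _ a≡b _ | _ = ⊥-elim (a≢b a≡b)
... | _ | tri≈ _ c≡d _ = ⊥-elim (c≢d c≡d)
... | tri< a<b _ _ | tri< c<d _ _ = inj₁ (powers-ordered a b c d a<b c<d e)
... | tri< a<b _ _ | tri> _ _ d<c = inj₂ (powers-ordered a b d c a<b d<c (trans e (+-comm (2 ^ c) _)))
... | tri> _ _ b<a | tri< c<d _ _ with powers-ordered b a c d b<a c<d (trans (+-comm (2 ^ b) _) e)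
...   | b≡c , a≡d = inj₂ (a≡d , b≡c)
powers-unique a b c d _ _ e | tri> _ _ b<a | tri> _ _ d<c
  with powers-ordered b a d c b<a d<c (trans (+-comm (2 ^ b) _) (trans e (+-comm (2 ^ c) _)))
... | b≡d , a≡c = inj₁ (a≡c , b≡d)

label : Bool → ℕ → List ℕ
label false a = a ∷ []
label true a = a ∷ suc a ∷ []

label-least : ∀ s a → a ∈ label s a × (∀ {z} → z ∈ label s a → a ≤ z)
label-least false a = here refl , λ { (here refl) → ≤-refl }
label-least true a = here refl , λ { (here refl) → ≤-refl ; (there (here refl)) → n≤1+n a }

card-pair : ∀ {x y} → x ≢ y → card (x ∷ y ∷ []) ≡ 2
card-pair {x} {y} x≢y rewrite ≢⇒≡ᵇ-false x≢y = refl

card-label : ∀ s a → (card (label s a) ≡ᵇ 1) ≡ not s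
card-label false a = refl
card-label true a = cong (_≡ᵇ 1) (card-pair (<⇒≢ (n<1+n a)))

card-label-sum : ∀ s t a c → s ∧ t ≡ false →
  card (sumset (label s a) (label t c)) ≡ card (label s a) ⊔ card (label t c)
card-label-sum false false a c _ = refl
card-label-sum false true a c _ =
  trans (card-pair (<⇒≢ (subst (a + c <_) (sym (+-suc a c)) (n<1+n (a + c)))))
        (cong (1 ⊔_) (sym (card-pair (<⇒≢ (n<1+n c)))))
card-label-sum true false a c _ =
  trans (card-pair (<⇒≢ (n<1+n (a + c))))
        (cong (_⊔ 1) (sym (card-pair (<⇒≢ (n<1+n a)))))

label-sum-least : ∀ s t a c → a + c ∈ sumset (label s a) (label t c) ×
  (∀ {z} → z ∈ sumset (label s a) (label t c) → a + c ≤ z)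
label-sum-least s t a c =
  ∈-sumset⁺ (label s a) (label t c) (proj₁ (label-least s a)) (proj₁ (label-least t c)) , above
  where
    above : ∀ {z} → z ∈ sumset (label s a) (label t c) → a + c ≤ z
    above z∈ with ∈-sumset⁻ (label s a) (label t c) z∈
    ... | x , y , x∈ , y∈ , refl = +-mono-≤ (proj₂ (label-least s a) x∈) (proj₂ (label-least t c) y∈)

SetEq-least : ∀ X Y {a c} → SetEq X Y →
  a ∈ X × (∀ {z} → z ∈ X → a ≤ z) → c ∈ Y × (∀ {z} → z ∈ Y → c ≤ z) → a ≡ c
SetEq-least X Y {a} {c} X≈Y (a∈ , a-least) (c∈ , c-least) =
  ≤-antisym (a-least (proj₂ (X≈Y c) c∈)) (c-least (proj₁ (X≈Y a) a∈))

odd : ℕ → Bool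
odd zero = false
odd (suc zero) = true
odd (suc (suc a)) = odd a

odd-suc : ∀ a → odd (suc a) ≡ not (odd a)
odd-suc zero = refl
odd-suc (suc zero) = refl
odd-suc (suc (suc a)) = odd-suc a

count-odd : ∀ n → ∑[ j < n ] ind (odd (toℕ j)) ≡ n / 2
count-odd zero = refl
count-odd (suc zero) = refl
count-odd (suc (suc n)) = trans (cong suc (count-odd n)) (sym (m/n≡1+[m∸n]/n {suc (suc n)} {2} (s≤s (s≤s z≤n))))

-- Odd vertices of the cycle ℤ_n are never cyclic neighbours (0 is even).
odd-nxt : ∀ {n a} → odd a ≡ true → odd (nxt n a) ≡ true → ⊥
odd-nxt {n} {a} odd-a odd-nxt-a with suc a ≡ᵇ n
... | true = false≢true odd-nxt-a
... | false = false≢true (trans (sym (cong not odd-a)) (trans (sym (odd-suc a)) odd-nxt-a))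

module Construction (n : ℕ) (3≤n : 3 ≤ n) where
  open SunSquare n

  spare : Fin (n + n) → Bool
  spare x = [ (λ _ → false) , (λ j → odd (toℕ j)) ]′ (splitAt n x)

  spare-u : ∀ i → spare (u i) ≡ false
  spare-u i rewrite splitAt-↑ˡ n i n = refl

  spare-w : ∀ j → spare (w j) ≡ odd (toℕ j)
  spare-w j rewrite splitAt-↑ʳ n n j = refl

  spare-independent : ∀ x y → G² x y ≡ true → spare x ∧ spare y ≡ false
  spare-independent x y xy with vertex-cases x | vertex-cases y
  ... | inj₁ (i , refl) | _ rewrite spare-u i = refl
  ... | inj₂ (j , refl) | inj₁ (i , refl) rewrite spare-u i | spare-w j = ∧-zeroʳ (odd (toℕ j))
  ... | inj₂ (j , refl) | inj₂ (k , refl) rewrite spare-w j | spare-w k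
    with odd (toℕ j) in odd-j | odd (toℕ k) in odd-k
  ...   | false | _ = refl
  ...   | true | false = refl
  ...   | true | true with ∨-true⁻ {toℕ k ≡ᵇ nxt n (toℕ j)} (G²-ww⇒cyclic j k xy)
  ...     | inj₁ k≡nxt = ⊥-elim (odd-nxt {n} odd-j (trans (cong odd (sym (≡ᵇ⇒≡′ {toℕ k} k≡nxt))) odd-k))
  ...     | inj₂ k≡prv = ⊥-elim (odd-nxt {n} {toℕ k} odd-k
              (trans (cong odd (trans (cong (nxt n) (≡ᵇ⇒≡′ {toℕ k} k≡prv)) (nxt-prv (toℕ<n j)))) odd-j))

  labelling : Fin (n + n) → List ℕ
  labelling x = label (spare x) (2 ^ toℕ x)

  least : ∀ x → 2 ^ toℕ x ∈ labelling x × (∀ {z} → z ∈ labelling x → 2 ^ toℕ x ≤ z)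
  least x = label-least (spare x) (2 ^ toℕ x)

  iasi : WeakIASI (n + n) G²
  iasi = record
    { f = labelling
    ; nonempty = nonempty
    ; f-inj = λ x y x≈y → toℕ-injective (2^-injective (SetEq-least _ _ x≈y (least x) (least y)))
    ; f⁺-inj = edge-inj
    ; weak = λ x y xy → card-label-sum (spare x) (spare y) _ _ (spare-independent x y xy)
    }
    where
      nonempty : ∀ x → labelling x ≢ []
      nonempty x with spare x
      ... | false = λ ()
      ... | true = λ ()
      sum-least : ∀ x y → 2 ^ toℕ x + 2 ^ toℕ y ∈ sumset (labelling x) (labelling y) ×
                  (∀ {z} → z ∈ sumset (labelling x) (labelling y) → 2 ^ toℕ x + 2 ^ toℕ y ≤ z)
      sum-least x y = label-sum-least (spare x) (spare y) (2 ^ toℕ x) (2 ^ toℕ y)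
      -- The least element 2^x + 2^y of an edge label determines the edge.
      edge-inj : ∀ x y x′ y′ → G² x y ≡ true → G² x′ y′ ≡ true →
        SetEq (sumset (labelling x) (labelling y)) (sumset (labelling x′) (labelling y′)) →
        (x ≡ x′ × y ≡ y′) ⊎ (x ≡ y′ × y ≡ x′)
      edge-inj x y x′ y′ xy x′y′ same
        with powers-unique (toℕ x) (toℕ y) (toℕ x′) (toℕ y′) (G²-loopless x y xy) (G²-loopless x′ y′ x′y′)
               (SetEq-least _ _ same (sum-least x y) (sum-least x′ y′))
      ... | inj₁ (x≡x′ , y≡y′) = inj₁ (toℕ-injective x≡x′ , toℕ-injective y≡y′)
      ... | inj₂ (x≡y′ , y≡x′) = inj₂ (toℕ-injective x≡y′ , toℕ-injective y≡x′)

  mono-iasi : ∀ x → Mono.mono iasi x ≡ not (spare x)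
  mono-iasi x = card-label (spare x) (2 ^ toℕ x)

  spared-iasi : Mono.spared iasi ≡ (n / 2) * (n + 2)
  spared-iasi = trans (sum-split n n _) (cong₂ _+_ U-part W-part)
    where
      spared-ind : ∀ x → ind (not (Mono.mono iasi x)) ≡ ind (spare x)
      spared-ind x = cong ind (trans (cong not (mono-iasi x)) (not-involutive (spare x)))
      U-part : ∑[ i < n ] (ind (not (Mono.mono iasi (u i))) * degree G² (u i)) ≡ 0
      U-part = trans (sum-cong n (λ i → cong (_* degree G² (u i)) (trans (spared-ind (u i)) (cong ind (spare-u i)))))
                     (sum-zero n)
      W-part : ∑[ j < n ] (ind (not (Mono.mono iasi (w j))) * degree G² (w j)) ≡ (n / 2) * (n + 2)
      W-part = trans (sum-cong n (λ j → cong₂ _*_ (trans (spared-ind (w j)) (cong ind (spare-w j))) (degree-w 3≤n j)))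
                     (trans (sum-*ʳ n _ (n + 2)) (cong (_* (n + 2)) (count-odd n)))

-- The final arithmetic: for odd n = 2k + 1,
--   2(n² + 1) + 2k(n + 2) = n(2n - 1) + n(n + 2)
-- (in the solver's identity n - 1 is written out as 2k, which is definitional).
odd-total : ∀ n k → n ≡ suc (k * 2) →
  (n * n + 1) * 2 + 2 * (k * (n + 2)) ≡ n * (n ∸ 1 + n) + n * (n + 2)
odd-total _ k refl = identity k
  where
    identity : ∀ k → (suc (k * 2) * suc (k * 2) + 1) * 2 + 2 * (k * (suc (k * 2) + 2))
                     ≡ suc (k * 2) * (k * 2 + suc (k * 2)) + suc (k * 2) * (suc (k * 2) + 2)
    identity = solve-∀

-- and for even n = 2k > 0 (with k = m + 1, so that the truncated
-- subtractions again compute),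
--   2k(2n - 1) + 2k(n + 2) = n(2n - 1) + n(n + 2).
even-total : ∀ n k → n ≡ k * 2 → 0 < n →
  (k * (2 * n ∸ 1)) * 2 + 2 * (k * (n + 2)) ≡ n * (n ∸ 1 + n) + n * (n + 2)
even-total _ (suc m) refl _ = identity m
  where
    identity : ∀ m → (suc m * (1 + m * 2 + (2 + m * 2 + 0))) * 2 + 2 * (suc m * (2 + m * 2 + 2))
                     ≡ (2 + m * 2) * (1 + m * 2 + (2 + m * 2)) + (2 + m * 2) * (2 + m * 2 + 2)
    identity = solve-∀

theorem2p9 : (n : ℕ) → 3 ≤ n →
    (n % 2 ≡ 1 → IsSparingNumber (n + n) (square (completeSun n)) (n * n + 1))
      × (n % 2 ≡ 0 → IsSparingNumber (n + n) (square (completeSun n)) ((n / 2) * (2 * n ∸ 1)))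
theorem2p9 n 3≤n =
  (λ n-odd → sparing (n * n + 1) (odd-total n (n / 2) (n≡rem+half*2 n-odd))) ,
  (λ n-even → sparing ((n / 2) * (2 * n ∸ 1)) (even-total n (n / 2) (n≡rem+half*2 n-even) (≤-trans (s≤s z≤n) 3≤n)))
  where
    open SunSquare n
    n≡rem+half*2 : ∀ {r} → n % 2 ≡ r → n ≡ r + (n / 2) * 2
    n≡rem+half*2 n%2≡r = trans (m≡m%n+[m/n]*n n 2) (cong (_+ (n / 2) * 2) n%2≡r)
    sparing : ∀ v → v * 2 + 2 * ((n / 2) * (n + 2)) ≡ n * (n ∸ 1 + n) + n * (n + 2) →
              IsSparingNumber (n + n) G² v
    sparing v total = sparing-number G²-sym G²-loopless ((n / 2) * (n + 2)) v
      (SparedBound.spared-bound n 3≤n) (Construction.iasi n 3≤n) (Construction.spared-iasi n 3≤n)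
      (trans total (sym (total-degree 3≤n)))
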